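{- For every $k\geq 1$, $\rho^\mathfrak{K}_{k+2}\circ\partial_k = q\frac{d}{dq}\circ\rho^\mathfrak{K}_k$ as maps $\mathcal{E}_k\to\widetilde{\mathcal{M}}_{k+2}$, i.e. the square with horizontal arrows $\rho^\mathfrak{K}_k:\mathcal{E}_k\to\widetilde{\mathcal{M}}_k$, $\rho^\mathfrak{K}_{k+2}:\mathcal{E}_{k+2}\to\widetilde{\mathcal{M}}_{k+2}$ and vertical arrows $\partial_k$, $q\frac{d}{dq}$ commutes.
   Context: $\mathcal{E}_K$ is the formal double Eisenstein space spanned by symbols $G\left(\begin{smallmatrix}k\\d\end{smallmatrix}\right)$, $G\left(\begin{smallmatrix}k_1,k_2\\d_1,d_2\end{smallmatrix}\right)$, $P\left(\begin{smallmatrix}k_1,k_2\\d_1,d_2\end{smallmatrix}\right)$ ($k,k_i\ge1$, $d,d_i\ge0$, $k+d=k_1+k_2+d_1+d_2=K$) modulo the coefficient relations of $\mathfrak{P}=\mathfrak{G}_2\mid(1+\epsilon)+\mathfrak{R}^\ast_{\mathfrak{G}_1}=\mathfrak{G}_2\mid T(1+\epsilon)+\mathfrak{R}^{\sqcup\!\sqcup}_{\mathfrak{G}_1}$, where $\mathfrak{G}_1=\sum G\left(\begin{smallmatrix}k\\d\end{smallmatrix}\right)X^{k-1}\frac{Y^d}{d!}$, $\mathfrak{G}_2=\sum G\left(\begin{smallmatrix}k_1,k_2\\d_1,d_2\end{smallmatrix}\right)X_1^{k_1-1}X_2^{k_2-1}\frac{Y_1^{d_1}}{d_1!}\frac{Y_2^{d_2}}{d_2!}$,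 $\mathfrak{P}$ likewise; the action is $(R\mid\gamma)(X_1,X_2;Y_1,Y_2)=R(aX_1+bX_2,cX_1+dX_2;\det\gamma(dY_1-cY_2),\det\gamma(-bY_1+aY_2))$ for $\gamma=\begin{pmatrix}a&b\\c&d\end{pmatrix}$, $\epsilon=\begin{pmatrix}0&1\\1&0\end{pmatrix}$, $T=\begin{pmatrix}1&1\\0&1\end{pmatrix}$, $\mathfrak{R}^\ast_{\mathfrak{T}}=\frac{\mathfrak{T}(X_1;Y_1+Y_2)-\mathfrak{T}(X_2;Y_1+Y_2)}{X_1-X_2}$, $\mathfrak{R}^{\sqcup\!\sqcup}_{\mathfrak{T}}=\frac{\mathfrak{T}(X_1+X_2;Y_1)-\mathfrak{T}(X_1+X_2;Y_2)}{Y_1-Y_2}$. The $\mathbb Q$-linear map $\partial_k:\mathcal{E}_k\to\mathcal{E}_{k+2}$ is $G\left(\begin{smallmatrix}k\\d\end{smallmatrix}\right)\mapsto kG\left(\begin{smallmatrix}k+1\\d+1\end{smallmatrix}\right)$, $G\left(\begin{smallmatrix}k_1,k_2\\d_1,d_2\end{smallmatrix}\right)\mapsto k_1G\left(\begin{smallmatrix}k_1+1,k_2\\d_1+1,d_2\end{smallmatrix}\right)+k_2G\left(\begin{smallmatrix}k_1,k_2+1\\d_1,d_2+1\end{smallmatrix}\right)$. $\widetilde{\mathcal{M}}=\mathbb Q[G_2,G_4,G_6]$ is the weight-graded algebra of quasimodular forms, with $G_k=-\frac{B_k}{2k!}+\frac1{(k-1)!}\sum_{n\ge1}\frac{n^{k-1}q^n}{1-q^n}$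 ($k$ even), $G_k=0$ ($k$ odd). $\rho^\mathfrak{K}_k:\mathcal{E}_k\to\widetilde{\mathcal{M}}_k$ is the Kronecker realization: with $\mathfrak{B}_1(X;Y)=\sum_{r,s\ge0,\,r+s\text{ odd}}\frac{|r-s|!}{r!}(q\frac{d}{dq})^{\min\{r,s\}}G_{|r-s|+1}X^r\frac{Y^s}{s!}$ (the non-polar part of the Kronecker function $\mathfrak{K}_q(X;Y)=-\frac12(\frac1X+\frac1Y)+\mathfrak{B}_1(X;Y)$), $\mathfrak{P}_\mathfrak{B}=\mathfrak{B}_1(X_1;Y_1)\mathfrak{B}_1(X_2;Y_2)$, $U=\begin{pmatrix}1&-1\\1&0\end{pmatrix}$ and $\mathfrak{B}_2=\frac13\mathfrak{P}_\mathfrak{B}\mid(1+T^{ -1})-\frac1{12}\mathfrak{R}^\ast_{\mathfrak{B}_1}\mid(5-3U+U\epsilon)-\frac1{12}\mathfrak{R}^{\sqcup\!\sqcup}_{\mathfrak{B}_1}\mid(T^{ -1}(5-3\epsilon+U))$, it sends the generators of $\mathcal{E}_k$ to the corresponding coefficients of $\mathfrak{B}_1$, $\mathfrak{B}_2$, $\mathfrak{P}_\mathfrak{B}$. -}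

module Defs where

open import Data.Nat as ℕ using (ℕ; zero; suc; _≤_; _⊓_; ∣_-_∣; _!; _∸_; _≡ᵇ_)
open import Data.Nat.Combinatorics using (_C_)
open import Data.Nat.Divisibility using (_∣?_)
open import Data.Integer using (+_)
open import Data.Rational using (ℚ; 0ℚ; 1ℚ; _+_; _*_; -_; _-_; _/_)
open import Data.Bool using (Bool; true; false; if_then_else_)
open import Data.Product using (_×_; _,_)
open import Data.List using (List; []; _∷_; concatMap)
open import Relation.Nullary using (does)
open import Relation.Binary.PropositionalEquality using (_≡_)

ℕ→ℚ : ℕ → ℚ
ℕ→ℚ n = (+ n) / 1

-- a / b for natural numbers (only ever used with b ≠ 0; value 0 if b = 0)
frac : ℕ → ℕ → ℚ
frac a zero    = 0ℚ
frac a (suc b) = (+ a) / suc b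

powℚ : ℚ → ℕ → ℚ
powℚ x zero    = 1ℚ
powℚ x (suc n) = x * powℚ x n

sumTo : ℕ → (ℕ → ℚ) → ℚ
sumTo zero    f = f 0
sumTo (suc n) f = sumTo n f + f (suc n)

-- Bernoulli numbers:  B₀ = 1,  Σ_{j=0}^{n} C(n+1,j) B_j = 0  (n ≥ 1)

bernoulliUpTo : ℕ → (ℕ → ℚ)   -- bernoulliUpTo n j = B_j for j ≤ n
bernoulliUpTo zero    = λ _ → 1ℚ
bernoulliUpTo (suc n) = λ j → if j ≡ᵇ suc n then new else prev j
  where
  prev : ℕ → ℚ
  prev = bernoulliUpTo n
  new : ℚ
  new = - (frac 1 (suc (suc n)) * sumTo n (λ j → ℕ→ℚ (suc (suc n) C j) * prev j))

bernoulli : ℕ → ℚ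
bernoulli n = bernoulliUpTo n n

-- Formal q-series with rational coefficients (q-expansions)

PS : Set
PS = ℕ → ℚ

0ₚ : PS
0ₚ _ = 0ℚ

_+ₚ_ : PS → PS → PS
(f +ₚ g) n = f n + g n

_·ₚ_ : ℚ → PS → PS
(c ·ₚ f) n = c * f n

_*ₚ_ : PS → PS → PS
(f *ₚ g) n = sumTo n (λ i → f i * g (n ∸ i))

Dq : PS → PS
Dq f n = ℕ→ℚ n * f n

Dq^ : ℕ → PS → PS
Dq^ zero    f = f
Dq^ (suc m) f = Dq (Dq^ m f)

-- coefficient of q^m (m ≥ 1) in Σ_{n≥1} n^{e} qⁿ/(1-qⁿ)
lambertCoeff : ℕ → ℕ → ℚ
lambertCoeff e m = sumTo m (λ n → if does (n ∣? m) then (if n ≡ᵇ 0 then 0ℚ else ℕ→ℚ (n ℕ.^ e)) else 0ℚ)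

isEven : ℕ → Bool
isEven zero          = true
isEven (suc zero)    = false
isEven (suc (suc n)) = isEven n

-- G_k = -B_k/(2 k!) + 1/(k-1)! Σ_{n≥1} n^{k-1} qⁿ/(1-qⁿ) for k even (k ≥ 2), G_k = 0 for k odd
Gq : ℕ → PS
Gq zero    = 0ₚ          -- never used
Gq (suc j) with isEven (suc j)
... | false = 0ₚ
... | true  = λ { zero → - (bernoulli (suc j) * frac 1 (2 ℕ.* (suc j !)))
                ; (suc m) → frac 1 (j !) * lambertCoeff j (suc m) }

-- Non-polar part of the Kronecker function:
-- 𝔅₁(X;Y) = Σ_{r+s odd} |r-s|!/r! (q d/dq)^{min r s} G_{|r-s|+1} X^r Y^s/s!
-- B1 r s = ordinary coefficient of X^r Y^s.

B1 : ℕ → ℕ → PS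
B1 r s = if isEven (r ℕ.+ s) then 0ₚ
         else ((frac (∣ r - s ∣ !) (r !) * frac 1 (s !)) ·ₚ Dq^ (r ⊓ s) (Gq (suc ∣ r - s ∣)))

-- Series in X₁,X₂,Y₁,Y₂ with q-series coefficients, given by ordinary
-- coefficients:  R a₁ a₂ b₁ b₂ = coefficient of X₁^a₁ X₂^a₂ Y₁^b₁ Y₂^b₂.

Ser4 : Set
Ser4 = ℕ → ℕ → ℕ → ℕ → PS

infixl 6 _+₄_ _+ₚ_
infixr 7 _·₄_ _·ₚ_ _*ₚ_

_+₄_ : Ser4 → Ser4 → Ser4
(R +₄ S) a₁ a₂ b₁ b₂ = R a₁ a₂ b₁ b₂ +ₚ S a₁ a₂ b₁ b₂

_·₄_ : ℚ → Ser4 → Ser4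
(c ·₄ R) a₁ a₂ b₁ b₂ = c ·ₚ R a₁ a₂ b₁ b₂

record Mat : Set where
  constructor mat
  field a b c d : ℚ

_⊗_ : Mat → Mat → Mat
mat a b c d ⊗ mat a' b' c' d' =
  mat (a * a' + b * c') (a * b' + b * d') (c * a' + d * c') (c * b' + d * d')

det : Mat → ℚ
det (mat a b c d) = a * d - b * c


𝟙 ε T⁻¹ U : Mat
𝟙   = mat 1ℚ 0ℚ 0ℚ 1ℚ
ε   = mat 0ℚ 1ℚ 1ℚ 0ℚ
T⁻¹ = mat 1ℚ (- 1ℚ) 0ℚ 1ℚ
U   = mat 1ℚ (- 1ℚ) 1ℚ 0ℚ

-- coefficient of Z₁^e Z₂^(i+j-e) in (α Z₁ + β Z₂)^i (γ Z₁ + δ Z₂)^j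
linCoeff : ℚ → ℚ → ℚ → ℚ → ℕ → ℕ → ℕ → ℚ
linCoeff α β γ δ i j e =
  sumTo i (λ u → sumTo j (λ v →
    if (u ℕ.+ v) ≡ᵇ e
    then ℕ→ℚ (i C u) * powℚ α u * powℚ β (i ∸ u)
         * (ℕ→ℚ (j C v) * powℚ γ v * powℚ δ (j ∸ v))
    else 0ℚ))

-- (R ∣ γ)(X₁,X₂;Y₁,Y₂) = R(aX₁+bX₂, cX₁+dX₂; detγ(dY₁-cY₂), detγ(-bY₁+aY₂))
slash : Ser4 → Mat → Ser4
slash R (mat a b c d) a₁ a₂ b₁ b₂ n =
  sumTo (a₁ ℕ.+ a₂) (λ i → sumTo (b₁ ℕ.+ b₂) (λ l →
    R i ((a₁ ℕ.+ a₂) ∸ i) l ((b₁ ℕ.+ b₂) ∸ l) n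
    * (linCoeff a b c d i ((a₁ ℕ.+ a₂) ∸ i) a₁
       * linCoeff (Δ * d) (Δ * (- c)) (Δ * (- b)) (Δ * a) l ((b₁ ℕ.+ b₂) ∸ l) b₁)))
  where Δ = det (mat a b c d)

-- Coefficients of 𝔗(X)=Σ T r s X^r Y^s (ordinary coefficients):
-- ℜ*_𝔗 = (𝔗(X₁;Y₁+Y₂) - 𝔗(X₂;Y₁+Y₂))/(X₁-X₂)
--      = Σ T r s (Σ_{i+j=r-1} X₁^i X₂^j) (Y₁+Y₂)^s
Rstar : (ℕ → ℕ → PS) → Ser4
Rstar T a₁ a₂ b₁ b₂ = ℕ→ℚ ((b₁ ℕ.+ b₂) C b₁) ·ₚ T (suc (a₁ ℕ.+ a₂)) (b₁ ℕ.+ b₂)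

-- ℜ⧢_𝔗 = (𝔗(X₁+X₂;Y₁) - 𝔗(X₁+X₂;Y₂))/(Y₁-Y₂)
--      = Σ T r s (X₁+X₂)^r (Σ_{i+j=s-1} Y₁^i Y₂^j)
Rsh : (ℕ → ℕ → PS) → Ser4
Rsh T a₁ a₂ b₁ b₂ = ℕ→ℚ ((a₁ ℕ.+ a₂) C a₁) ·ₚ T (a₁ ℕ.+ a₂) (suc (b₁ ℕ.+ b₂))

PB : Ser4
PB a₁ a₂ b₁ b₂ = B1 a₁ b₁ *ₚ B1 a₂ b₂

B2 : Ser4
B2 =
  (frac 1 3 ·₄ (slash PB 𝟙 +₄ slash PB T⁻¹))
  +₄ ((- frac 1 12) ·₄ ((ℕ→ℚ 5 ·₄ slash (Rstar B1) 𝟙)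
                       +₄ ((- ℕ→ℚ 3) ·₄ slash (Rstar B1) U)
                       +₄ slash (Rstar B1) (U ⊗ ε)))
  +₄ ((- frac 1 12) ·₄ ((ℕ→ℚ 5 ·₄ slash (Rsh B1) T⁻¹)
                       +₄ ((- ℕ→ℚ 3) ·₄ slash (Rsh B1) (T⁻¹ ⊗ ε))
                       +₄ slash (Rsh B1) (T⁻¹ ⊗ U)))

-- Generators of the formal double Eisenstein space

data Gen : Set where
  G₁ : (k d : ℕ) → Gen
  G₂ : (k₁ k₂ d₁ d₂ : ℕ) → Gen

IsGenOfWeight : ℕ → Gen → Set
IsGenOfWeight K (G₁ k d)          = (1 ≤ k) × (k ℕ.+ d ≡ K)
IsGenOfWeight K (G₂ k₁ k₂ d₁ d₂)  = (1 ≤ k₁) × (1 ≤ k₂) × (k₁ ℕ.+ k₂ ℕ.+ d₁ ℕ.+ d₂ ≡ K)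

-- formal ℚ-linear combinations of generators
Comb : Set
Comb = List (ℚ × Gen)

∂gen : Gen → Comb
∂gen (G₁ k d)         = (ℕ→ℚ k , G₁ (suc k) (suc d)) ∷ []
∂gen (G₂ k₁ k₂ d₁ d₂) = (ℕ→ℚ k₁ , G₂ (suc k₁) k₂ (suc d₁) d₂)
                      ∷ (ℕ→ℚ k₂ , G₂ k₁ (suc k₂) d₁ (suc d₂)) ∷ []

∂ : Comb → Comb
∂ = concatMap (λ { (c , g) → scale c (∂gen g) })
  where
  scale : ℚ → Comb → Comb
  scale c []             = []
  scale c ((c' , g) ∷ x) = (c * c' , g) ∷ scale c x

-- Kronecker realization on generators (q-expansion), extended linearly:
-- ρ(G(k;d)) = coefficient of X^{k-1} Y^d/d! in 𝔅₁,
-- ρ(G(k₁,k₂;d₁,d₂)) = coefficient of X₁^{k₁-1}X₂^{k₂-1}Y₁^{d₁}/d₁! Y₂^{d₂}/d₂! in 𝔅₂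
ρgen : Gen → PS
ρgen (G₁ k d)         = ℕ→ℚ (d !) ·ₚ B1 (k ∸ 1) d
ρgen (G₂ k₁ k₂ d₁ d₂) = ℕ→ℚ (d₁ ! ℕ.* d₂ !) ·ₚ B2 (k₁ ∸ 1) (k₂ ∸ 1) d₁ d₂

ρ : Comb → PS
ρ []            = 0ₚ
ρ ((c , g) ∷ x) = (c ·ₚ ρgen g) +ₚ ρ x

-- The non-polar part 𝔅₁ of the Kronecker function solves the heat equation q d/dq 𝔅₁ = ∂_X ∂_Y 𝔅₁:
-- raising both indices of a coefficient by one applies one more q d/dq to the same Eisenstein series.
-- In two pairs of variables the operator ∂_{X₁}∂_{Y₁} + ∂_{X₂}∂_{Y₂} is respected by products of
-- solutions, by ℜ* and ℜ⧢, and by the slash action of every γ with (det γ)² = 1, because the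
-- Y-variables are transformed by det γ times the inverse transpose of γ.  So 𝔅₂, a linear combination
-- of such terms, solves it as well.  On the coefficients normalised by d! (resp. d₁! d₂!), as ρ reads
-- them, the heat operator becomes exactly ∂, which proves ρ ∘ ∂ = q d/dq ∘ ρ generator by generator.

module Submission where

open import Defs
open import Data.Nat using (ℕ; _≤_)
open import Data.Product using (proj₂)
open import Data.Product using (_,_)
open import Data.List.Relation.Unary.All using (All)
open import Data.List.Relation.Unary.All using ([]; _∷_)
open import Data.List using ([]; _∷_)
open import Relation.Binary.PropositionalEquality using (_≡_)

open import Level using (0ℓ)
open import Function using (_∘_)
open import Data.Bool using (Bool; true; false; if_then_else_; T)
open import Data.Sum using (inj₁; inj₂)
open import Data.Nat as ℕ using (zero; suc; _∸_; _≡ᵇ_; _!; NonZero; z≤n; s≤s)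
open import Data.Nat.Combinatorics using (_C_; nCk+nC[k+1]≡[n+1]C[k+1]; nCk≡nC[n∸k]; nC1≡n)
open import Data.Nat.Combinatorics.Specification using (k>n⇒nCk≡0)
import Data.Nat.Properties as ℕP
import Data.Nat.Tactic.RingSolver as ℕ-Solver
import Data.Nat.Coprimality as Coprime
open import Data.Integer as ℤ using (+_)
import Data.Integer.Properties as ℤP
open import Data.Rational as ℚ using (ℚ; mkℚ; 0ℚ; 1ℚ; _+_; _*_; -_; _-_)
import Data.Rational.Properties as ℚP
import Data.Rational.Unnormalised as ℚᵘ
import Data.Rational.Unnormalised.Properties as ℚᵘP
open import Relation.Nullary.Decidable using (dec⇒maybe)
open import Relation.Binary.PropositionalEquality
open import Tactic.RingSolver using (solve-∀)
open import Tactic.RingSolver.Core.AlmostCommutativeRing using (AlmostCommutativeRing; fromCommutativeRing)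

ℚ-ring : AlmostCommutativeRing 0ℓ 0ℓ
ℚ-ring = fromCommutativeRing ℚP.+-*-commutativeRing (λ x → dec⇒maybe (0ℚ ℚP.≟ x))

ℕ→ℚ≡mkℚ : ∀ n → ℕ→ℚ n ≡ mkℚ (+ n) 0 (Coprime.sym (Coprime.1-coprimeTo n))
ℕ→ℚ≡mkℚ n = ℚP.normalize-coprime (Coprime.sym (Coprime.1-coprimeTo n))

ℕ→ℚ-+ : ∀ m n → ℕ→ℚ (m ℕ.+ n) ≡ ℕ→ℚ m + ℕ→ℚ n
ℕ→ℚ-+ m n rewrite ℕ→ℚ≡mkℚ m | ℕ→ℚ≡mkℚ n = ℚP./-cong {p₁ = + (m ℕ.+ n)}
  (trans (ℤP.pos-+ m n) (sym (cong₂ ℤ._+_ (ℤP.*-identityʳ (+ m)) (ℤP.*-identityʳ (+ n))))) refl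

ℕ→ℚ-* : ∀ m n → ℕ→ℚ (m ℕ.* n) ≡ ℕ→ℚ m * ℕ→ℚ n
ℕ→ℚ-* m n rewrite ℕ→ℚ≡mkℚ m | ℕ→ℚ≡mkℚ n = ℚP./-cong {p₁ = + (m ℕ.* n)} (ℤP.pos-* m n) refl

ℕ→ℚ-*-cong : ∀ a b c d → a ℕ.* b ≡ c ℕ.* d → ℕ→ℚ a * ℕ→ℚ b ≡ ℕ→ℚ c * ℕ→ℚ d
ℕ→ℚ-*-cong a b c d eq = trans (sym (ℕ→ℚ-* a b)) (trans (cong ℕ→ℚ eq) (ℕ→ℚ-* c d))

[m+n]*[x*y]≡m*x*y+x*[n*y] : ∀ m n x y → ℕ→ℚ (m ℕ.+ n) * (x * y) ≡ ℕ→ℚ m * x * y + x * (ℕ→ℚ n * y)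
[m+n]*[x*y]≡m*x*y+x*[n*y] m n x y =
  trans (cong (_* (x * y)) (ℕ→ℚ-+ m n)) (distrib (ℕ→ℚ m) (ℕ→ℚ n) x y)
  where
  distrib : ∀ a b x y → (a + b) * (x * y) ≡ a * x * y + x * (b * y)
  distrib = solve-∀ ℚ-ring

0*a*x≡0 : ∀ a x → 0ℚ * a * x ≡ 0ℚ
0*a*x≡0 a x = trans (cong (_* x) (ℚP.*-zeroˡ a)) (ℚP.*-zeroˡ x)

x*0*y≡0 : ∀ x y → x * 0ℚ * y ≡ 0ℚ
x*0*y≡0 x y = trans (cong (_* y) (ℚP.*-zeroʳ x)) (ℚP.*-zeroˡ y)

frac-cancelˡ : ∀ D m k .{{_ : NonZero k}} → ℕ→ℚ (suc m) * frac D (suc m ℕ.* k) ≡ frac D k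
frac-cancelˡ D m (suc k) = ℚP.toℚᵘ-injective (begin
  ℚ.toℚᵘ (ℕ→ℚ (suc m) * frac D (suc m ℕ.* suc k))
    ≈⟨ ℚP.toℚᵘ-homo-* (ℕ→ℚ (suc m)) (frac D (suc m ℕ.* suc k)) ⟩
  ℚ.toℚᵘ (ℕ→ℚ (suc m)) ℚᵘ.* ℚ.toℚᵘ (frac D (suc m ℕ.* suc k))
    ≈⟨ ℚᵘP.*-cong (ℚP.toℚᵘ-fromℚᵘ (ℚᵘ.mkℚᵘ (+ suc m) 0))
                  (ℚP.toℚᵘ-fromℚᵘ (ℚᵘ.mkℚᵘ (+ D) (k ℕ.+ m ℕ.* suc k))) ⟩
  ℚᵘ.mkℚᵘ (+ suc m) 0 ℚᵘ.* ℚᵘ.mkℚᵘ (+ D) (k ℕ.+ m ℕ.* suc k)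
    ≈⟨ ℚᵘ.*≡* cross-multiplied ⟩
  ℚᵘ.mkℚᵘ (+ D) k
    ≈⟨ ℚᵘP.≃-sym (ℚP.toℚᵘ-fromℚᵘ (ℚᵘ.mkℚᵘ (+ D) k)) ⟩
  ℚ.toℚᵘ (frac D (suc k)) ∎)
  where
  open ℚᵘP.≃-Reasoning
  cross-multiplied : (+ suc m ℤ.* + D) ℤ.* + suc k ≡ + D ℤ.* + (1 ℕ.* (suc m ℕ.* suc k))
  cross-multiplied = ≡.begin
    (+ suc m ℤ.* + D) ℤ.* + suc k  ≡.≡⟨ cong (ℤ._* + suc k) (ℤP.*-comm (+ suc m) (+ D)) ⟩
    (+ D ℤ.* + suc m) ℤ.* + suc k  ≡.≡⟨ ℤP.*-assoc (+ D) (+ suc m) (+ suc k) ⟩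
    + D ℤ.* (+ suc m ℤ.* + suc k)  ≡.≡⟨ cong (+ D ℤ.*_) (sym (ℤP.pos-* (suc m) (suc k))) ⟩
    + D ℤ.* + (suc m ℕ.* suc k)    ≡.≡⟨ cong (λ n → + D ℤ.* + n) (sym (ℕP.*-identityˡ (suc m ℕ.* suc k))) ⟩
    + D ℤ.* + (1 ℕ.* (suc m ℕ.* suc k)) ≡.∎
    where module ≡ = ≡-Reasoning

frac-!-cancelˡ : ∀ D r → ℕ→ℚ (suc r) * frac D (suc r !) ≡ frac D (r !)
frac-!-cancelˡ D r = frac-cancelˡ D r (r !) {{ℕP._!≢0 r}}

sumTo-cong : ∀ n {f g : ℕ → ℚ} → (∀ i → i ≤ n → f i ≡ g i) → sumTo n f ≡ sumTo n g
sumTo-cong zero    f≗g = f≗g 0 z≤n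
sumTo-cong (suc n) f≗g =
  cong₂ _+_ (sumTo-cong n (λ i i≤n → f≗g i (ℕP.m≤n⇒m≤1+n i≤n))) (f≗g (suc n) ℕP.≤-refl)

sumTo-+ : ∀ n (f g : ℕ → ℚ) → sumTo n (λ i → f i + g i) ≡ sumTo n f + sumTo n g
sumTo-+ zero    f g = refl
sumTo-+ (suc n) f g = trans (cong (_+ (f (suc n) + g (suc n))) (sumTo-+ n f g))
  (interchange (sumTo n f) (sumTo n g) (f (suc n)) (g (suc n)))
  where
  interchange : ∀ a b c d → a + b + (c + d) ≡ a + c + (b + d)
  interchange = solve-∀ ℚ-ring

sumTo-*ˡ : ∀ n c (f : ℕ → ℚ) → sumTo n (λ i → c * f i) ≡ c * sumTo n f
sumTo-*ˡ zero    c f = refl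
sumTo-*ˡ (suc n) c f = trans (cong (_+ c * f (suc n)) (sumTo-*ˡ n c f))
  (sym (ℚP.*-distribˡ-+ c (sumTo n f) (f (suc n))))

sumTo-zero : ∀ n (f : ℕ → ℚ) → (∀ i → i ≤ n → f i ≡ 0ℚ) → sumTo n f ≡ 0ℚ
sumTo-zero zero    f f≡0 = f≡0 0 z≤n
sumTo-zero (suc n) f f≡0 = trans (cong₂ _+_ (sumTo-zero n f (λ i i≤n → f≡0 i (ℕP.m≤n⇒m≤1+n i≤n)))
  (f≡0 (suc n) ℕP.≤-refl)) (ℚP.+-identityˡ 0ℚ)

sumTo-suc-head : ∀ n (f : ℕ → ℚ) → f 0 ≡ 0ℚ → sumTo (suc n) f ≡ sumTo n (f ∘ suc)
sumTo-suc-head zero    f f0≡0 = trans (cong (_+ f 1) f0≡0) (ℚP.+-identityˡ (f 1))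
sumTo-suc-head (suc n) f f0≡0 = cong (_+ f (suc (suc n))) (sumTo-suc-head n f f0≡0)

sumTo-suc-last : ∀ n (f : ℕ → ℚ) → f (suc n) ≡ 0ℚ → sumTo (suc n) f ≡ sumTo n f
sumTo-suc-last n f fn≡0 = trans (cong (λ x → sumTo n f + x) fn≡0) (ℚP.+-identityʳ (sumTo n f))

sumTo² : ℕ → ℕ → (ℕ → ℕ → ℚ) → ℚ
sumTo² m n F = sumTo m (λ i → sumTo n (F i))

sumTo²-cong : ∀ m n {F G : ℕ → ℕ → ℚ} → (∀ i j → i ≤ m → j ≤ n → F i j ≡ G i j) →
              sumTo² m n F ≡ sumTo² m n G
sumTo²-cong m n F≗G = sumTo-cong m (λ i i≤m → sumTo-cong n (λ j j≤n → F≗G i j i≤m j≤n))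

sumTo²-+ : ∀ m n (F G : ℕ → ℕ → ℚ) →
           sumTo² m n (λ i j → F i j + G i j) ≡ sumTo² m n F + sumTo² m n G
sumTo²-+ m n F G = trans (sumTo-cong m (λ i _ → sumTo-+ n (F i) (G i))) (sumTo-+ m _ _)

sumTo²-*ˡ : ∀ m n c (F : ℕ → ℕ → ℚ) → sumTo² m n (λ i j → c * F i j) ≡ c * sumTo² m n F
sumTo²-*ˡ m n c F = trans (sumTo-cong m (λ i _ → sumTo-*ˡ n c (F i))) (sumTo-*ˡ m c _)

sumTo²-swap : ∀ m n (F : ℕ → ℕ → ℚ) → sumTo² m n F ≡ sumTo² n m (λ j i → F i j)
sumTo²-swap zero    n F = refl
sumTo²-swap (suc m) n F = trans (cong (_+ sumTo n (F (suc m))) (sumTo²-swap m n F))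
  (sym (sumTo-+ n (λ j → sumTo m (λ i → F i j)) (F (suc m))))

sumTo²-suc-head : ∀ m n (F : ℕ → ℕ → ℚ) → (∀ j → F 0 j ≡ 0ℚ) → (∀ i → F i 0 ≡ 0ℚ) →
                  sumTo² (suc m) (suc n) F ≡ sumTo² m n (λ i j → F (suc i) (suc j))
sumTo²-suc-head m n F row₀≡0 col₀≡0 =
  trans (sumTo-suc-head m _ (sumTo-zero (suc n) (F 0) (λ j _ → row₀≡0 j)))
        (sumTo-cong m (λ i _ → sumTo-suc-head n (F (suc i)) (col₀≡0 (suc i))))

sumTo²-suc-last : ∀ m n (F : ℕ → ℕ → ℚ) → (∀ j → F (suc m) j ≡ 0ℚ) → (∀ i → F i (suc n) ≡ 0ℚ) →
                  sumTo² (suc m) (suc n) F ≡ sumTo² m n F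
sumTo²-suc-last m n F rowₘ≡0 colₙ≡0 =
  trans (sumTo-suc-last m _ (sumTo-zero (suc n) (F (suc m)) (λ j _ → rowₘ≡0 j)))
        (sumTo-cong m (λ i _ → sumTo-suc-last n (F i) (colₙ≡0 i)))

sumOver : ℕ → ℕ → (ℕ → ℕ → ℕ → ℕ → ℚ) → ℚ
sumOver A B H = sumTo² A B (λ i l → H i (A ∸ i) l (B ∸ l))

sumOver-cong : ∀ A B {H H′ : ℕ → ℕ → ℕ → ℕ → ℚ} →
  (∀ i j l m → i ℕ.+ j ≡ A → l ℕ.+ m ≡ B → H i j l m ≡ H′ i j l m) → sumOver A B H ≡ sumOver A B H′
sumOver-cong A B H≗H′ = sumTo²-cong A B (λ i l i≤A l≤B →
  H≗H′ i (A ∸ i) l (B ∸ l) (ℕP.m+[n∸m]≡n i≤A) (ℕP.m+[n∸m]≡n l≤B))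

sumOver-+ : ∀ A B (H H′ : ℕ → ℕ → ℕ → ℕ → ℚ) →
  sumOver A B (λ i j l m → H i j l m + H′ i j l m) ≡ sumOver A B H + sumOver A B H′
sumOver-+ A B H H′ = sumTo²-+ A B (λ i l → H i (A ∸ i) l (B ∸ l)) (λ i l → H′ i (A ∸ i) l (B ∸ l))

sumOver-*ˡ : ∀ A B c (H : ℕ → ℕ → ℕ → ℕ → ℚ) →
  sumOver A B (λ i j l m → c * H i j l m) ≡ c * sumOver A B H
sumOver-*ˡ A B c H = sumTo²-*ˡ A B c (λ i l → H i (A ∸ i) l (B ∸ l))

sumOver-shift₁ : ∀ A B (H : ℕ → ℕ → ℕ → ℕ → ℚ) →
  sumOver (suc A) (suc B) (λ i j l m → ℕ→ℚ i * ℕ→ℚ l * H i j l m)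
  ≡ sumOver A B (λ i j l m → ℕ→ℚ (suc i) * ℕ→ℚ (suc l) * H (suc i) j (suc l) m)
sumOver-shift₁ A B H = sumTo²-suc-head A B _ (λ l → 0*a*x≡0 (ℕ→ℚ l) _) (λ i → x*0*y≡0 (ℕ→ℚ i) _)

sumOver-shift₂ : ∀ A B (H : ℕ → ℕ → ℕ → ℕ → ℚ) →
  sumOver (suc A) (suc B) (λ i j l m → ℕ→ℚ j * ℕ→ℚ m * H i j l m)
  ≡ sumOver A B (λ i j l m → ℕ→ℚ (suc j) * ℕ→ℚ (suc m) * H i (suc j) l (suc m))
sumOver-shift₂ A B H = trans (sumTo²-suc-last A B _ last-row-zero last-column-zero)
  (sumTo²-cong A B (λ i l i≤A l≤B → cong₂ (λ j m → ℕ→ℚ j * ℕ→ℚ m * H i j l m)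
    (ℕP.+-∸-assoc 1 i≤A) (ℕP.+-∸-assoc 1 l≤B)))
  where
  last-row-zero : ∀ l → ℕ→ℚ (A ∸ A) * ℕ→ℚ (suc B ∸ l) * H (suc A) (A ∸ A) l (suc B ∸ l) ≡ 0ℚ
  last-row-zero l = trans (cong (λ k → ℕ→ℚ k * ℕ→ℚ (suc B ∸ l) * H (suc A) k l (suc B ∸ l)) (ℕP.n∸n≡0 A))
                          (0*a*x≡0 (ℕ→ℚ (suc B ∸ l)) (H (suc A) 0 l (suc B ∸ l)))
  last-column-zero : ∀ i → ℕ→ℚ (suc A ∸ i) * ℕ→ℚ (B ∸ B) * H i (suc A ∸ i) (suc B) (B ∸ B) ≡ 0ℚ
  last-column-zero i = trans (cong (λ k → ℕ→ℚ (suc A ∸ i) * ℕ→ℚ k * H i (suc A ∸ i) (suc B) k) (ℕP.n∸n≡0 B))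
                             (x*0*y≡0 (ℕ→ℚ (suc A ∸ i)) (H i (suc A ∸ i) (suc B) 0))

1+k+w∸k≡1+w : ∀ k w → suc (k ℕ.+ w) ∸ k ≡ suc w
1+k+w∸k≡1+w k w = trans (cong (_∸ k) (sym (ℕP.+-suc k w))) (ℕP.m+n∸m≡n k (suc w))

[1+k]*[1+n]C[1+k]≡[1+n]*nCk : ∀ n k → suc k ℕ.* (suc n C suc k) ≡ suc n ℕ.* (n C k)
[1+k]*[1+n]C[1+k]≡[1+n]*nCk zero    zero    = refl
[1+k]*[1+n]C[1+k]≡[1+n]*nCk zero    (suc k)
  rewrite k>n⇒nCk≡0 {1} {suc (suc k)} (s≤s (s≤s z≤n)) | k>n⇒nCk≡0 {0} {suc k} (s≤s z≤n)
  = ℕP.*-zeroʳ (suc (suc k))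
[1+k]*[1+n]C[1+k]≡[1+n]*nCk (suc n) zero
  rewrite nC1≡n (suc (suc n)) =
  cong (λ m → suc (suc m)) (trans (ℕP.+-identityʳ n) (sym (ℕP.*-identityʳ n)))
[1+k]*[1+n]C[1+k]≡[1+n]*nCk (suc n) (suc k) = begin
  suc (suc k) ℕ.* (suc (suc n) C suc (suc k))
    ≡⟨ cong (suc (suc k) ℕ.*_) (sym (nCk+nC[k+1]≡[n+1]C[k+1] (suc n) (suc k))) ⟩
  suc (suc k) ℕ.* (x ℕ.+ z)
    ≡⟨ expand k x z ⟩
  suc k ℕ.* x ℕ.+ x ℕ.+ suc (suc k) ℕ.* z
    ≡⟨ cong₂ (λ p q → p ℕ.+ x ℕ.+ q) ([1+k]*[1+n]C[1+k]≡[1+n]*nCk n k) ([1+k]*[1+n]C[1+k]≡[1+n]*nCk n (suc k)) ⟩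
  suc n ℕ.* (n C k) ℕ.+ x ℕ.+ suc n ℕ.* (n C suc k)
    ≡⟨ cong (λ y → suc n ℕ.* (n C k) ℕ.+ y ℕ.+ suc n ℕ.* (n C suc k)) (sym (nCk+nC[k+1]≡[n+1]C[k+1] n k)) ⟩
  suc n ℕ.* (n C k) ℕ.+ (n C k ℕ.+ n C suc k) ℕ.+ suc n ℕ.* (n C suc k)
    ≡⟨ collect n (n C k) (n C suc k) ⟩
  suc (suc n) ℕ.* (n C k ℕ.+ n C suc k)
    ≡⟨ cong (suc (suc n) ℕ.*_) (nCk+nC[k+1]≡[n+1]C[k+1] n k) ⟩
  suc (suc n) ℕ.* x ∎
  where
  open ≡-Reasoning
  x = suc n C suc k
  z = suc n C suc (suc k)
  expand : ∀ k x z → suc (suc k) ℕ.* (x ℕ.+ z) ≡ suc k ℕ.* x ℕ.+ x ℕ.+ suc (suc k) ℕ.* z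
  expand = ℕ-Solver.solve-∀
  collect : ∀ n a b → suc n ℕ.* a ℕ.+ (a ℕ.+ b) ℕ.+ suc n ℕ.* b ≡ suc (suc n) ℕ.* (a ℕ.+ b)
  collect = ℕ-Solver.solve-∀

[1+w]*[1+k+w]Ck≡[1+k+w]*[k+w]Ck : ∀ k w → suc w ℕ.* (suc (k ℕ.+ w) C k) ≡ suc (k ℕ.+ w) ℕ.* ((k ℕ.+ w) C k)
[1+w]*[1+k+w]Ck≡[1+k+w]*[k+w]Ck k w = begin
  suc w ℕ.* (suc (k ℕ.+ w) C k)
    ≡⟨ cong (suc w ℕ.*_) (nCk≡nC[n∸k] (ℕP.m≤n⇒m≤1+n (ℕP.m≤m+n k w))) ⟩
  suc w ℕ.* (suc (k ℕ.+ w) C (suc (k ℕ.+ w) ∸ k))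
    ≡⟨ cong (λ j → suc w ℕ.* (suc (k ℕ.+ w) C j)) (1+k+w∸k≡1+w k w) ⟩
  suc w ℕ.* (suc (k ℕ.+ w) C suc w)
    ≡⟨ [1+k]*[1+n]C[1+k]≡[1+n]*nCk (k ℕ.+ w) w ⟩
  suc (k ℕ.+ w) ℕ.* ((k ℕ.+ w) C w)
    ≡⟨ cong (λ j → suc (k ℕ.+ w) ℕ.* ((k ℕ.+ w) C j)) (sym (ℕP.m+n∸m≡n k w)) ⟩
  suc (k ℕ.+ w) ℕ.* ((k ℕ.+ w) C ((k ℕ.+ w) ∸ k))
    ≡⟨ cong (suc (k ℕ.+ w) ℕ.*_) (sym (nCk≡nC[n∸k] (ℕP.m≤m+n k w))) ⟩
  suc (k ℕ.+ w) ℕ.* ((k ℕ.+ w) C k) ∎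
  where open ≡-Reasoning

Dq-*ₚ : ∀ (f g : PS) n → Dq (f *ₚ g) n ≡ (Dq f *ₚ g) n + (f *ₚ Dq g) n
Dq-*ₚ f g n = begin
  ℕ→ℚ n * sumTo n (λ i → f i * g (n ∸ i))
    ≡⟨ sym (sumTo-*ˡ n (ℕ→ℚ n) (λ i → f i * g (n ∸ i))) ⟩
  sumTo n (λ i → ℕ→ℚ n * (f i * g (n ∸ i)))
    ≡⟨ sumTo-cong n split ⟩
  sumTo n (λ i → ℕ→ℚ i * f i * g (n ∸ i) + f i * (ℕ→ℚ (n ∸ i) * g (n ∸ i)))
    ≡⟨ sumTo-+ n _ _ ⟩
  (Dq f *ₚ g) n + (f *ₚ Dq g) n ∎
  where
  open ≡-Reasoning
  split : ∀ i → i ≤ n → ℕ→ℚ n * (f i * g (n ∸ i))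
                      ≡ ℕ→ℚ i * f i * g (n ∸ i) + f i * (ℕ→ℚ (n ∸ i) * g (n ∸ i))
  split i i≤n = trans (cong (λ m → ℕ→ℚ m * (f i * g (n ∸ i))) (sym (ℕP.m+[n∸m]≡n i≤n)))
    ([m+n]*[x*y]≡m*x*y+x*[n*y] i (n ∸ i) (f i) (g (n ∸ i)))

*ₚ-congˡ : ∀ {f f′} (g : PS) → (∀ i → f i ≡ f′ i) → ∀ n → (f *ₚ g) n ≡ (f′ *ₚ g) n
*ₚ-congˡ g f≗f′ n = sumTo-cong n (λ i _ → cong (_* g (n ∸ i)) (f≗f′ i))

*ₚ-congʳ : ∀ (f : PS) {g g′} → (∀ i → g i ≡ g′ i) → ∀ n → (f *ₚ g) n ≡ (f *ₚ g′) n
*ₚ-congʳ f g≗g′ n = sumTo-cong n (λ i _ → cong (f i *_) (g≗g′ (n ∸ i)))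

·ₚ-*ₚ-assoc : ∀ c (f g : PS) n → ((c ·ₚ f) *ₚ g) n ≡ c * (f *ₚ g) n
·ₚ-*ₚ-assoc c f g n =
  trans (sumTo-cong n (λ i _ → ℚP.*-assoc c (f i) (g (n ∸ i)))) (sumTo-*ˡ n c _)

*ₚ-·ₚ-comm : ∀ c (f g : PS) n → (f *ₚ (c ·ₚ g)) n ≡ c * (f *ₚ g) n
*ₚ-·ₚ-comm c f g n = trans (sumTo-cong n (λ i _ → swap c (f i) (g (n ∸ i)))) (sumTo-*ˡ n c _)
  where
  swap : ∀ c x y → x * (c * y) ≡ c * (x * y)
  swap = solve-∀ ℚ-ring

-- q d/dq 𝔗 = ∂_X ∂_Y 𝔗, written on the ordinary coefficients of 𝔗 = Σ T r s X^r Y^s.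
Heat₁ : (ℕ → ℕ → PS) → Set
Heat₁ T = ∀ r s n → Dq (T r s) n ≡ ℕ→ℚ (suc r) * ℕ→ℚ (suc s) * T (suc r) (suc s) n

-- Raising r and s by one keeps r + s mod 2 and |r - s|, adds one q d/dq, and divides r! s! by (r+1)(s+1).
heat-B1 : Heat₁ B1
heat-B1 r s n rewrite ℕP.+-suc r s with isEven (r ℕ.+ s)
... | true  = trans (ℚP.*-zeroʳ (ℕ→ℚ n)) (sym (ℚP.*-zeroʳ (ℕ→ℚ (suc r) * ℕ→ℚ (suc s))))
... | false = begin
  ℕ→ℚ n * (frac D (r !) * frac 1 (s !) * G n)
    ≡⟨ cong₂ (λ x y → ℕ→ℚ n * (x * y * G n)) (sym (frac-!-cancelˡ D r)) (sym (frac-!-cancelˡ 1 s)) ⟩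
  ℕ→ℚ n * ((ℕ→ℚ (suc r) * frac D (suc r !)) * (ℕ→ℚ (suc s) * frac 1 (suc s !)) * G n)
    ≡⟨ regroup (ℕ→ℚ n) (ℕ→ℚ (suc r)) (frac D (suc r !)) (ℕ→ℚ (suc s)) (frac 1 (suc s !)) (G n) ⟩
  ℕ→ℚ (suc r) * ℕ→ℚ (suc s) * (frac D (suc r !) * frac 1 (suc s !) * (ℕ→ℚ n * G n)) ∎
  where
  open ≡-Reasoning
  D = ℕ.∣ r - s ∣ !
  G = Dq^ (r ℕ.⊓ s) (Gq (suc ℕ.∣ r - s ∣))
  regroup : ∀ n a x b y g → n * ((a * x) * (b * y) * g) ≡ a * b * (x * y * (n * g))
  regroup = solve-∀ ℚ-ring

-- The same heat equation in two pairs of variables, q d/dq = ∂_{X₁} ∂_{Y₁} + ∂_{X₂} ∂_{Y₂}.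
Heat₂ : Ser4 → Set
Heat₂ R = ∀ a₁ a₂ b₁ b₂ n → Dq (R a₁ a₂ b₁ b₂) n ≡
  ℕ→ℚ (suc a₁) * ℕ→ℚ (suc b₁) * R (suc a₁) a₂ (suc b₁) b₂ n
  + ℕ→ℚ (suc a₂) * ℕ→ℚ (suc b₂) * R a₁ (suc a₂) b₁ (suc b₂) n

heat-+₄ : ∀ R S → Heat₂ R → Heat₂ S → Heat₂ (R +₄ S)
heat-+₄ R S heatR heatS a₁ a₂ b₁ b₂ n =
  trans (ℚP.*-distribˡ-+ (ℕ→ℚ n) (R a₁ a₂ b₁ b₂ n) (S a₁ a₂ b₁ b₂ n))
  (trans (cong₂ _+_ (heatR a₁ a₂ b₁ b₂ n) (heatS a₁ a₂ b₁ b₂ n))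
         (interchange (ℕ→ℚ (suc a₁) * ℕ→ℚ (suc b₁)) (ℕ→ℚ (suc a₂) * ℕ→ℚ (suc b₂))
                      (R (suc a₁) a₂ (suc b₁) b₂ n) (R a₁ (suc a₂) b₁ (suc b₂) n)
                      (S (suc a₁) a₂ (suc b₁) b₂ n) (S a₁ (suc a₂) b₁ (suc b₂) n)))
  where
  interchange : ∀ κ κ′ x y z w → (κ * x + κ′ * y) + (κ * z + κ′ * w) ≡ κ * (x + z) + κ′ * (y + w)
  interchange = solve-∀ ℚ-ring

heat-·₄ : ∀ c R → Heat₂ R → Heat₂ (c ·₄ R)
heat-·₄ c R heatR a₁ a₂ b₁ b₂ n =
  trans (commute (ℕ→ℚ n) c (R a₁ a₂ b₁ b₂ n))
  (trans (cong (c *_) (heatR a₁ a₂ b₁ b₂ n))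
         (distrib c (ℕ→ℚ (suc a₁) * ℕ→ℚ (suc b₁)) (ℕ→ℚ (suc a₂) * ℕ→ℚ (suc b₂))
                  (R (suc a₁) a₂ (suc b₁) b₂ n) (R a₁ (suc a₂) b₁ (suc b₂) n)))
  where
  commute : ∀ n c x → n * (c * x) ≡ c * (n * x)
  commute = solve-∀ ℚ-ring
  distrib : ∀ c κ κ′ x y → c * (κ * x + κ′ * y) ≡ κ * (c * x) + κ′ * (c * y)
  distrib = solve-∀ ℚ-ring

heat-⊗ : ∀ S T → Heat₁ S → Heat₁ T → Heat₂ (λ a₁ a₂ b₁ b₂ → S a₁ b₁ *ₚ T a₂ b₂)
heat-⊗ S T heatS heatT a₁ a₂ b₁ b₂ n = begin
  Dq (S a₁ b₁ *ₚ T a₂ b₂) n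
    ≡⟨ Dq-*ₚ (S a₁ b₁) (T a₂ b₂) n ⟩
  (Dq (S a₁ b₁) *ₚ T a₂ b₂) n + (S a₁ b₁ *ₚ Dq (T a₂ b₂)) n
    ≡⟨ cong₂ _+_ (*ₚ-congˡ (T a₂ b₂) (heatS a₁ b₁) n) (*ₚ-congʳ (S a₁ b₁) (heatT a₂ b₂) n) ⟩
  ((κ₁ ·ₚ S (suc a₁) (suc b₁)) *ₚ T a₂ b₂) n + (S a₁ b₁ *ₚ (κ₂ ·ₚ T (suc a₂) (suc b₂))) n
    ≡⟨ cong₂ _+_ (·ₚ-*ₚ-assoc κ₁ (S (suc a₁) (suc b₁)) (T a₂ b₂) n)
                 (*ₚ-·ₚ-comm κ₂ (S a₁ b₁) (T (suc a₂) (suc b₂)) n) ⟩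
  κ₁ * (S (suc a₁) (suc b₁) *ₚ T a₂ b₂) n + κ₂ * (S a₁ b₁ *ₚ T (suc a₂) (suc b₂)) n ∎
  where
  open ≡-Reasoning
  κ₁ = ℕ→ℚ (suc a₁) * ℕ→ℚ (suc b₁)
  κ₂ = ℕ→ℚ (suc a₂) * ℕ→ℚ (suc b₂)

heat-Rstar : ∀ T → Heat₁ T → Heat₂ (Rstar T)
heat-Rstar T heatT a₁ a₂ b₁ b₂ n = begin
  ℕ→ℚ n * (c * T (suc A) B n)
    ≡⟨ commute (ℕ→ℚ n) c (T (suc A) B n) ⟩
  c * (ℕ→ℚ n * T (suc A) B n)
    ≡⟨ cong (c *_) (heatT (suc A) B n) ⟩
  c * (ℕ→ℚ (suc (suc A)) * s * t)
    ≡⟨ cong (λ z → c * (ℕ→ℚ z * s * t)) (sym (ℕP.+-suc (suc a₁) a₂)) ⟩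
  c * (ℕ→ℚ (suc a₁ ℕ.+ suc a₂) * s * t)
    ≡⟨ cong (λ z → c * (z * s * t)) (ℕ→ℚ-+ (suc a₁) (suc a₂)) ⟩
  c * ((α₁ + α₂) * s * t)
    ≡⟨ distrib c α₁ α₂ s t ⟩
  α₁ * (s * c) * t + α₂ * (s * c) * t
    ≡⟨ cong₂ (λ u v → α₁ * u * t + α₂ * v * t)
         (ℕ→ℚ-*-cong (suc B) (B C b₁) (suc b₁) (suc B C suc b₁) (sym ([1+k]*[1+n]C[1+k]≡[1+n]*nCk B b₁)))
         (ℕ→ℚ-*-cong (suc B) (B C b₁) (suc b₂) (suc B C b₁) (sym ([1+w]*[1+k+w]Ck≡[1+k+w]*[k+w]Ck b₁ b₂))) ⟩
  α₁ * (β₁ * c₁) * t + α₂ * (β₂ * c₂) * t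
    ≡⟨ regroup α₁ α₂ β₁ β₂ c₁ c₂ t ⟩
  α₁ * β₁ * (c₁ * t) + α₂ * β₂ * (c₂ * t)
    ≡⟨ cong (λ z → α₁ * β₁ * (c₁ * t) + α₂ * β₂ * z)
         (cong₂ (λ x y → ℕ→ℚ (y C b₁) * T (suc x) y n) (sym (ℕP.+-suc a₁ a₂)) (sym (ℕP.+-suc b₁ b₂))) ⟩
  α₁ * β₁ * Rstar T (suc a₁) a₂ (suc b₁) b₂ n + α₂ * β₂ * Rstar T a₁ (suc a₂) b₁ (suc b₂) n ∎
  where
  open ≡-Reasoning
  A = a₁ ℕ.+ a₂
  B = b₁ ℕ.+ b₂
  c = ℕ→ℚ (B C b₁)
  c₁ = ℕ→ℚ (suc B C suc b₁)
  c₂ = ℕ→ℚ (suc B C b₁)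
  s = ℕ→ℚ (suc B)
  t = T (suc (suc A)) (suc B) n
  α₁ = ℕ→ℚ (suc a₁)
  α₂ = ℕ→ℚ (suc a₂)
  β₁ = ℕ→ℚ (suc b₁)
  β₂ = ℕ→ℚ (suc b₂)
  commute : ∀ n c x → n * (c * x) ≡ c * (n * x)
  commute = solve-∀ ℚ-ring
  distrib : ∀ c α₁ α₂ s t → c * ((α₁ + α₂) * s * t) ≡ α₁ * (s * c) * t + α₂ * (s * c) * t
  distrib = solve-∀ ℚ-ring
  regroup : ∀ α₁ α₂ β₁ β₂ c₁ c₂ t → α₁ * (β₁ * c₁) * t + α₂ * (β₂ * c₂) * t ≡ α₁ * β₁ * (c₁ * t) + α₂ * β₂ * (c₂ * t)
  regroup = solve-∀ ℚ-ring

transpose₁ : (ℕ → ℕ → PS) → (ℕ → ℕ → PS)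
transpose₁ T r s = T s r

transpose₂ : Ser4 → Ser4
transpose₂ R a₁ a₂ b₁ b₂ = R b₁ b₂ a₁ a₂

heat-transpose₁ : ∀ T → Heat₁ T → Heat₁ (transpose₁ T)
heat-transpose₁ T heatT r s n =
  trans (heatT s r n) (cong (_* T (suc s) (suc r) n) (ℚP.*-comm (ℕ→ℚ (suc s)) (ℕ→ℚ (suc r))))

heat-transpose₂ : ∀ R → Heat₂ R → Heat₂ (transpose₂ R)
heat-transpose₂ R heatR a₁ a₂ b₁ b₂ n = trans (heatR b₁ b₂ a₁ a₂ n)
  (cong₂ (λ κ₁ κ₂ → κ₁ * R (suc b₁) b₂ (suc a₁) a₂ n + κ₂ * R b₁ (suc b₂) a₁ (suc a₂) n)
         (ℚP.*-comm (ℕ→ℚ (suc b₁)) (ℕ→ℚ (suc a₁))) (ℚP.*-comm (ℕ→ℚ (suc b₂)) (ℕ→ℚ (suc a₂))))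

-- ℜ⧢ is ℜ* with the roles of the X- and the Y-variables exchanged.
heat-Rsh : ∀ T → Heat₁ T → Heat₂ (Rsh T)
heat-Rsh T heatT =
  heat-transpose₂ (Rstar (transpose₁ T)) (heat-Rstar (transpose₁ T) (heat-transpose₁ T heatT))

powCoeff : ℚ → ℚ → ℕ → ℕ → ℚ
powCoeff α β i u = ℕ→ℚ (i C u) * powℚ α u * powℚ β (i ∸ u)

when : Bool → ℚ → ℚ
when b x = if b then x else 0ℚ

-- Coefficient of Z^e in (Σ_{u ≤ i} f u Z^u)(Σ_{v ≤ j} g v Z^v);
-- linCoeff α β γ δ i j is by definition conv (powCoeff α β i) (powCoeff γ δ j) i j.
conv : (ℕ → ℚ) → (ℕ → ℚ) → ℕ → ℕ → ℕ → ℚ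
conv f g i j e = sumTo² i j (λ u v → when ((u ℕ.+ v) ≡ᵇ e) (f u * g v))

when-zero : ∀ b {x} → x ≡ 0ℚ → when b x ≡ 0ℚ
when-zero true  x≡0 = x≡0
when-zero false _   = refl

*-when : ∀ c b x → c * when b x ≡ when b (c * x)
*-when c true  x = refl
*-when c false x = ℚP.*-zeroʳ c

conv-split : ∀ (w : ℚ) (f f′ g g′ : ℕ → ℚ) i j e →
  (∀ u v → u ≤ i → v ≤ j → u ℕ.+ v ≡ e → w * (f u * g v) ≡ f′ u * g v + f u * g′ v) →
  w * conv f g i j e ≡ conv f′ g i j e + conv f g′ i j e
conv-split w f f′ g g′ i j e split =
  trans (sym (sumTo²-*ˡ i j w _)) (trans (sumTo²-cong i j termwise) (sumTo²-+ i j _ _))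
  where
  termwise : ∀ u v → u ≤ i → v ≤ j →
    w * when ((u ℕ.+ v) ≡ᵇ e) (f u * g v)
    ≡ when ((u ℕ.+ v) ≡ᵇ e) (f′ u * g v) + when ((u ℕ.+ v) ≡ᵇ e) (f u * g′ v)
  termwise u v u≤i v≤j with (u ℕ.+ v) ≡ᵇ e in eq
  ... | true  = split u v u≤i v≤j (ℕP.≡ᵇ⇒≡ (u ℕ.+ v) e (subst T (sym eq) _))
  ... | false = ℚP.*-zeroʳ w

conv-congˡ : ∀ {f f′ : ℕ → ℚ} g i j e → (∀ u → u ≤ i → f u ≡ f′ u) → conv f g i j e ≡ conv f′ g i j e
conv-congˡ g i j e f≗f′ =
  sumTo²-cong i j (λ u v u≤i _ → cong (λ x → when ((u ℕ.+ v) ≡ᵇ e) (x * g v)) (f≗f′ u u≤i))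

conv-*ˡ : ∀ c (f g : ℕ → ℚ) i j e → conv (λ u → c * f u) g i j e ≡ c * conv f g i j e
conv-*ˡ c f g i j e = trans (sumTo²-cong i j (λ u v _ _ → termwise u v)) (sumTo²-*ˡ i j c _)
  where
  termwise : ∀ u v → when ((u ℕ.+ v) ≡ᵇ e) (c * f u * g v) ≡ c * when ((u ℕ.+ v) ≡ᵇ e) (f u * g v)
  termwise u v = trans (cong (when _) (ℚP.*-assoc c (f u) (g v))) (sym (*-when c _ _))

conv-comm : ∀ (f g : ℕ → ℚ) i j e → conv f g i j e ≡ conv g f j i e
conv-comm f g i j e = trans (sumTo²-swap i j _) (sumTo²-cong j i (λ v u _ _ →
  cong₂ (λ k x → when (k ≡ᵇ e) x) (ℕP.+-comm u v) (ℚP.*-comm (f u) (g v))))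

conv-row-zero : ∀ (f g : ℕ → ℚ) u j e → f u ≡ 0ℚ →
  sumTo j (λ v → when ((u ℕ.+ v) ≡ᵇ e) (f u * g v)) ≡ 0ℚ
conv-row-zero f g u j e fu≡0 =
  sumTo-zero j _ (λ v _ → when-zero _ (trans (cong (_* g v) fu≡0) (ℚP.*-zeroˡ (g v))))

conv-sucˡ : ∀ (f g : ℕ → ℚ) i j e → f 0 ≡ 0ℚ → conv f g (suc i) j (suc e) ≡ conv (f ∘ suc) g i j e
conv-sucˡ f g i j e f0≡0 = sumTo-suc-head i _ (conv-row-zero f g 0 j (suc e) f0≡0)

conv-dropˡ : ∀ (f g : ℕ → ℚ) i j e → f (suc i) ≡ 0ℚ → conv f g (suc i) j e ≡ conv f g i j e
conv-dropˡ f g i j e fi≡0 = sumTo-suc-last i _ (conv-row-zero f g (suc i) j e fi≡0)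

powCoeff-above : ∀ α β i → powCoeff α β i (suc i) ≡ 0ℚ
powCoeff-above α β i rewrite k>n⇒nCk≡0 (ℕP.n<1+n i) =
  trans (cong (_* powℚ β (i ∸ suc i)) (ℚP.*-zeroˡ (powℚ α (suc i)))) (ℚP.*-zeroˡ (powℚ β (i ∸ suc i)))

[1+u]*powCoeff : ∀ α β i u →
  ℕ→ℚ (suc u) * powCoeff α β (suc i) (suc u) ≡ ℕ→ℚ (suc i) * α * powCoeff α β i u
[1+u]*powCoeff α β i u = begin
  ℕ→ℚ (suc u) * (ℕ→ℚ (suc i C suc u) * (α * x) * y)  ≡⟨ regroup (ℕ→ℚ (suc u)) (ℕ→ℚ (suc i C suc u)) α x y ⟩
  ℕ→ℚ (suc u) * ℕ→ℚ (suc i C suc u) * α * x * y    ≡⟨ cong (λ z → z * α * x * y) absorb ⟩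
  ℕ→ℚ (suc i) * ℕ→ℚ (i C u) * α * x * y            ≡⟨ regroup′ (ℕ→ℚ (suc i)) (ℕ→ℚ (i C u)) α x y ⟩
  ℕ→ℚ (suc i) * α * (ℕ→ℚ (i C u) * x * y)          ∎
  where
  open ≡-Reasoning
  x = powℚ α u
  y = powℚ β (i ∸ u)
  absorb = ℕ→ℚ-*-cong (suc u) (suc i C suc u) (suc i) (i C u) ([1+k]*[1+n]C[1+k]≡[1+n]*nCk i u)
  regroup : ∀ s c a x y → s * (c * (a * x) * y) ≡ s * c * a * x * y
  regroup = solve-∀ ℚ-ring
  regroup′ : ∀ s c a x y → s * c * a * x * y ≡ s * a * (c * x * y)
  regroup′ = solve-∀ ℚ-ring

[i∸u]*powCoeff : ∀ α β {i u} → u ≤ i →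
  ℕ→ℚ (i ∸ u) * powCoeff α β i u ≡ ℕ→ℚ i * β * powCoeff α β (i ∸ 1) u
[i∸u]*powCoeff α β {i} {u} u≤i with ℕP.m≤n⇒m<n∨m≡n u≤i
... | inj₂ refl = trans (cong (λ k → ℕ→ℚ k * powCoeff α β u u) (ℕP.n∸n≡0 u))
  (trans (ℚP.*-zeroˡ (powCoeff α β u u)) (sym (rhs≡0 u)))
  where
  rhs≡0 : ∀ u → ℕ→ℚ u * β * powCoeff α β (u ∸ 1) u ≡ 0ℚ
  rhs≡0 zero    = trans (cong (_* powCoeff α β 0 0) (ℚP.*-zeroˡ β)) (ℚP.*-zeroˡ (powCoeff α β 0 0))
  rhs≡0 (suc u) = trans (cong (ℕ→ℚ (suc u) * β *_) (powCoeff-above α β u)) (ℚP.*-zeroʳ (ℕ→ℚ (suc u) * β))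
... | inj₁ u<i with ℕP.m≤n⇒∃[o]m+o≡n u<i
... | w , refl = begin
  ℕ→ℚ (suc (u ℕ.+ w) ∸ u) * (c′ * x * powℚ β (suc (u ℕ.+ w) ∸ u))
    ≡⟨ cong (λ k → ℕ→ℚ k * (c′ * x * powℚ β k)) (1+k+w∸k≡1+w u w) ⟩
  ℕ→ℚ (suc w) * (c′ * x * (β * y))            ≡⟨ regroup (ℕ→ℚ (suc w)) c′ x β y ⟩
  ℕ→ℚ (suc w) * c′ * x * β * y               ≡⟨ cong (λ z → z * x * β * y) absorb ⟩
  ℕ→ℚ (suc (u ℕ.+ w)) * c * x * β * y        ≡⟨ regroup′ (ℕ→ℚ (suc (u ℕ.+ w))) c x β y ⟩
  ℕ→ℚ (suc (u ℕ.+ w)) * β * (c * x * y)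
    ≡⟨ cong (λ k → ℕ→ℚ (suc (u ℕ.+ w)) * β * (c * x * powℚ β k)) (sym (ℕP.m+n∸m≡n u w)) ⟩
  ℕ→ℚ (suc (u ℕ.+ w)) * β * (c * x * powℚ β ((u ℕ.+ w) ∸ u)) ∎
  where
  open ≡-Reasoning
  x = powℚ α u
  y = powℚ β w
  c = ℕ→ℚ ((u ℕ.+ w) C u)
  c′ = ℕ→ℚ (suc (u ℕ.+ w) C u)
  absorb = ℕ→ℚ-*-cong (suc w) (suc (u ℕ.+ w) C u) (suc (u ℕ.+ w)) ((u ℕ.+ w) C u) ([1+w]*[1+k+w]Ck≡[1+k+w]*[k+w]Ck u w)
  regroup : ∀ s c x b y → s * (c * x * (b * y)) ≡ s * c * x * b * y
  regroup = solve-∀ ℚ-ring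
  regroup′ : ∀ s c x b y → s * c * x * b * y ≡ s * b * (c * x * y)
  regroup′ = solve-∀ ℚ-ring

conv-u*powCoeff : ∀ α β g i j e →
  conv (λ u → ℕ→ℚ u * powCoeff α β i u) g i j (suc e)
  ≡ ℕ→ℚ i * α * conv (powCoeff α β (i ∸ 1)) g (i ∸ 1) j e
conv-u*powCoeff α β g zero j e =
  trans (conv-row-zero (λ u → ℕ→ℚ u * powCoeff α β 0 u) g 0 j (suc e) (ℚP.*-zeroˡ (powCoeff α β 0 0))) (sym (0*a*x≡0 α _))
conv-u*powCoeff α β g (suc i) j e = begin
  conv (λ u → ℕ→ℚ u * powCoeff α β (suc i) u) g (suc i) j (suc e)
    ≡⟨ conv-sucˡ (λ u → ℕ→ℚ u * powCoeff α β (suc i) u) g i j e (ℚP.*-zeroˡ (powCoeff α β (suc i) 0)) ⟩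
  conv (λ u → ℕ→ℚ (suc u) * powCoeff α β (suc i) (suc u)) g i j e
    ≡⟨ conv-congˡ g i j e (λ u _ → [1+u]*powCoeff α β i u) ⟩
  conv (λ u → ℕ→ℚ (suc i) * α * powCoeff α β i u) g i j e
    ≡⟨ conv-*ˡ (ℕ→ℚ (suc i) * α) (powCoeff α β i) g i j e ⟩
  ℕ→ℚ (suc i) * α * conv (powCoeff α β i) g i j e ∎
  where open ≡-Reasoning

conv-[i∸u]*powCoeff : ∀ α β g i j e →
  conv (λ u → ℕ→ℚ (i ∸ u) * powCoeff α β i u) g i j e
  ≡ ℕ→ℚ i * β * conv (powCoeff α β (i ∸ 1)) g (i ∸ 1) j e
conv-[i∸u]*powCoeff α β g i j e = begin
  conv (λ u → ℕ→ℚ (i ∸ u) * powCoeff α β i u) g i j e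
    ≡⟨ conv-congˡ g i j e (λ u u≤i → [i∸u]*powCoeff α β u≤i) ⟩
  conv (λ u → ℕ→ℚ i * β * powCoeff α β (i ∸ 1) u) g i j e
    ≡⟨ conv-*ˡ (ℕ→ℚ i * β) (powCoeff α β (i ∸ 1)) g i j e ⟩
  ℕ→ℚ i * β * conv (powCoeff α β (i ∸ 1)) g i j e
    ≡⟨ cong (ℕ→ℚ i * β *_) (shrink i) ⟩
  ℕ→ℚ i * β * conv (powCoeff α β (i ∸ 1)) g (i ∸ 1) j e ∎
  where
  open ≡-Reasoning
  shrink : ∀ i → conv (powCoeff α β (i ∸ 1)) g i j e ≡ conv (powCoeff α β (i ∸ 1)) g (i ∸ 1) j e
  shrink zero    = refl
  shrink (suc i) = conv-dropˡ (powCoeff α β i) g i j e (powCoeff-above α β i)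

-- Z₁ ∂/∂Z₁ applied to (α Z₁ + β Z₂)^i (γ Z₁ + δ Z₂)^j.
linCoeff-∂₁ : ∀ α β γ δ i j e →
  ℕ→ℚ (suc e) * linCoeff α β γ δ i j (suc e)
  ≡ ℕ→ℚ i * α * linCoeff α β γ δ (i ∸ 1) j e + ℕ→ℚ j * γ * linCoeff α β γ δ i (j ∸ 1) e
linCoeff-∂₁ α β γ δ i j e = begin
  ℕ→ℚ (suc e) * conv P Q i j (suc e)
    ≡⟨ conv-split (ℕ→ℚ (suc e)) P (λ u → ℕ→ℚ u * P u) Q (λ v → ℕ→ℚ v * Q v) i j (suc e)
         (λ u v _ _ u+v≡1+e → trans (cong (λ k → ℕ→ℚ k * (P u * Q v)) (sym u+v≡1+e))
                                    ([m+n]*[x*y]≡m*x*y+x*[n*y] u v (P u) (Q v))) ⟩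
  conv (λ u → ℕ→ℚ u * P u) Q i j (suc e) + conv P (λ v → ℕ→ℚ v * Q v) i j (suc e)
    ≡⟨ cong₂ _+_ (conv-u*powCoeff α β Q i j e)
         (trans (conv-comm P _ i j (suc e)) (conv-u*powCoeff γ δ P j i e)) ⟩
  ℕ→ℚ i * α * conv (powCoeff α β (i ∸ 1)) Q (i ∸ 1) j e
  + ℕ→ℚ j * γ * conv (powCoeff γ δ (j ∸ 1)) P (j ∸ 1) i e
    ≡⟨ cong (λ x → ℕ→ℚ i * α * conv (powCoeff α β (i ∸ 1)) Q (i ∸ 1) j e + ℕ→ℚ j * γ * x)
         (conv-comm (powCoeff γ δ (j ∸ 1)) P (j ∸ 1) i e) ⟩
  ℕ→ℚ i * α * linCoeff α β γ δ (i ∸ 1) j e + ℕ→ℚ j * γ * linCoeff α β γ δ i (j ∸ 1) e ∎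
  where
  open ≡-Reasoning
  P = powCoeff α β i
  Q = powCoeff γ δ j

[i+j]∸[u+v]≡[i∸u]+[j∸v] : ∀ {i j u v} → u ≤ i → v ≤ j → (i ℕ.+ j) ∸ (u ℕ.+ v) ≡ (i ∸ u) ℕ.+ (j ∸ v)
[i+j]∸[u+v]≡[i∸u]+[j∸v] {i} {j} {u} {v} u≤i v≤j = begin
  (i ℕ.+ j) ∸ (u ℕ.+ v)  ≡⟨ sym (ℕP.∸-+-assoc (i ℕ.+ j) u v) ⟩
  (i ℕ.+ j) ∸ u ∸ v      ≡⟨ cong (_∸ v) (ℕP.+-∸-comm j u≤i) ⟩
  (i ∸ u ℕ.+ j) ∸ v      ≡⟨ ℕP.+-∸-assoc (i ∸ u) v≤j ⟩
  (i ∸ u) ℕ.+ (j ∸ v)    ∎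
  where open ≡-Reasoning

-- Z₂ ∂/∂Z₂ applied to (α Z₁ + β Z₂)^i (γ Z₁ + δ Z₂)^j.
linCoeff-∂₂ : ∀ α β γ δ i j e →
  ℕ→ℚ ((i ℕ.+ j) ∸ e) * linCoeff α β γ δ i j e
  ≡ ℕ→ℚ i * β * linCoeff α β γ δ (i ∸ 1) j e + ℕ→ℚ j * δ * linCoeff α β γ δ i (j ∸ 1) e
linCoeff-∂₂ α β γ δ i j e = begin
  ℕ→ℚ ((i ℕ.+ j) ∸ e) * conv P Q i j e
    ≡⟨ conv-split (ℕ→ℚ ((i ℕ.+ j) ∸ e)) P (λ u → ℕ→ℚ (i ∸ u) * P u) Q (λ v → ℕ→ℚ (j ∸ v) * Q v) i j e
         (λ u v u≤i v≤j u+v≡e → trans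
           (cong (λ k → ℕ→ℚ k * (P u * Q v))
                 (trans (cong ((i ℕ.+ j) ∸_) (sym u+v≡e)) ([i+j]∸[u+v]≡[i∸u]+[j∸v] u≤i v≤j)))
           ([m+n]*[x*y]≡m*x*y+x*[n*y] (i ∸ u) (j ∸ v) (P u) (Q v))) ⟩
  conv (λ u → ℕ→ℚ (i ∸ u) * P u) Q i j e + conv P (λ v → ℕ→ℚ (j ∸ v) * Q v) i j e
    ≡⟨ cong₂ _+_ (conv-[i∸u]*powCoeff α β Q i j e)
         (trans (conv-comm P _ i j e) (conv-[i∸u]*powCoeff γ δ P j i e)) ⟩
  ℕ→ℚ i * β * conv (powCoeff α β (i ∸ 1)) Q (i ∸ 1) j e
  + ℕ→ℚ j * δ * conv (powCoeff γ δ (j ∸ 1)) P (j ∸ 1) i e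
    ≡⟨ cong (λ x → ℕ→ℚ i * β * conv (powCoeff α β (i ∸ 1)) Q (i ∸ 1) j e + ℕ→ℚ j * δ * x)
         (conv-comm (powCoeff γ δ (j ∸ 1)) P (j ∸ 1) i e) ⟩
  ℕ→ℚ i * β * linCoeff α β γ δ (i ∸ 1) j e + ℕ→ℚ j * δ * linCoeff α β γ δ i (j ∸ 1) e ∎
  where
  open ≡-Reasoning
  P = powCoeff α β i
  Q = powCoeff γ δ j

module _ (γ : Mat) (det²≡1 : det γ * det γ ≡ 1ℚ) where
  open Mat γ

  private
    Δ : ℚ
    Δ = det γ

    Lx My : ℕ → ℕ → ℕ → ℚ
    Lx = linCoeff a b c d
    My = linCoeff (Δ * d) (Δ * (- c)) (Δ * (- b)) (Δ * a)

  -- In the product of the two derivative identities the mixed terms cancel, leaving the factor (det γ)² = 1.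
  linCoeff-heat : ∀ {i j l m} a₁ a₂ b₁ b₂ → i ℕ.+ j ≡ suc (a₁ ℕ.+ a₂) → l ℕ.+ m ≡ suc (b₁ ℕ.+ b₂) →
    ℕ→ℚ (suc a₁) * ℕ→ℚ (suc b₁) * (Lx i j (suc a₁) * My l m (suc b₁))
    + ℕ→ℚ (suc a₂) * ℕ→ℚ (suc b₂) * (Lx i j a₁ * My l m b₁)
    ≡ ℕ→ℚ i * ℕ→ℚ l * (Lx (i ∸ 1) j a₁ * My (l ∸ 1) m b₁)
    + ℕ→ℚ j * ℕ→ℚ m * (Lx i (j ∸ 1) a₁ * My l (m ∸ 1) b₁)
  linCoeff-heat {i} {j} {l} {m} a₁ a₂ b₁ b₂ i+j≡ l+m≡ = begin
    α₁ * β₁ * (Lx i j (suc a₁) * My l m (suc b₁)) + α₂ * β₂ * (Lx i j a₁ * My l m b₁)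
      ≡⟨ regroup α₁ β₁ α₂ β₂ (Lx i j (suc a₁)) (My l m (suc b₁)) (Lx i j a₁) (My l m b₁) ⟩
    (α₁ * Lx i j (suc a₁)) * (β₁ * My l m (suc b₁)) + (α₂ * Lx i j a₁) * (β₂ * My l m b₁)
      ≡⟨ cong₂ _+_ (cong₂ _*_ (linCoeff-∂₁ a b c d i j a₁) (linCoeff-∂₁ (Δ * d) (Δ * (- c)) (Δ * (- b)) (Δ * a) l m b₁))
                   (cong₂ _*_ (trans (cong (λ k → ℕ→ℚ k * Lx i j a₁) (sym (complement a₁ a₂ i+j≡)))
                                     (linCoeff-∂₂ a b c d i j a₁))
                              (trans (cong (λ k → ℕ→ℚ k * My l m b₁) (sym (complement b₁ b₂ l+m≡)))
                                     (linCoeff-∂₂ (Δ * d) (Δ * (- c)) (Δ * (- b)) (Δ * a) l m b₁))) ⟩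
    (ℕ→ℚ i * a * L₁ + ℕ→ℚ j * c * L₂) * (ℕ→ℚ l * (Δ * d) * M₁ + ℕ→ℚ m * (Δ * (- b)) * M₂)
    + (ℕ→ℚ i * b * L₁ + ℕ→ℚ j * d * L₂) * (ℕ→ℚ l * (Δ * (- c)) * M₁ + ℕ→ℚ m * (Δ * a) * M₂)
      ≡⟨ expand a b c d (ℕ→ℚ i) (ℕ→ℚ j) (ℕ→ℚ l) (ℕ→ℚ m) L₁ L₂ M₁ M₂ ⟩
    Δ * Δ * (ℕ→ℚ i * ℕ→ℚ l * (L₁ * M₁) + ℕ→ℚ j * ℕ→ℚ m * (L₂ * M₂))
      ≡⟨ trans (cong (_* ilLM+jmLM) det²≡1) (ℚP.*-identityˡ ilLM+jmLM) ⟩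
    ℕ→ℚ i * ℕ→ℚ l * (L₁ * M₁) + ℕ→ℚ j * ℕ→ℚ m * (L₂ * M₂) ∎
    where
    open ≡-Reasoning
    α₁ = ℕ→ℚ (suc a₁)
    α₂ = ℕ→ℚ (suc a₂)
    β₁ = ℕ→ℚ (suc b₁)
    β₂ = ℕ→ℚ (suc b₂)
    L₁ = Lx (i ∸ 1) j a₁
    L₂ = Lx i (j ∸ 1) a₁
    M₁ = My (l ∸ 1) m b₁
    M₂ = My l (m ∸ 1) b₁
    ilLM+jmLM = ℕ→ℚ i * ℕ→ℚ l * (L₁ * M₁) + ℕ→ℚ j * ℕ→ℚ m * (L₂ * M₂)
    complement : ∀ p q {r} → r ≡ suc (p ℕ.+ q) → r ∸ p ≡ suc q
    complement p q refl = 1+k+w∸k≡1+w p q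
    regroup : ∀ α₁ β₁ α₂ β₂ x₁ y₁ x₂ y₂ →
      α₁ * β₁ * (x₁ * y₁) + α₂ * β₂ * (x₂ * y₂) ≡ (α₁ * x₁) * (β₁ * y₁) + (α₂ * x₂) * (β₂ * y₂)
    regroup = solve-∀ ℚ-ring
    expand : ∀ a b c d i j l m L₁ L₂ M₁ M₂ →
      (i * a * L₁ + j * c * L₂) * (l * ((a * d - b * c) * d) * M₁ + m * ((a * d - b * c) * (- b)) * M₂)
      + (i * b * L₁ + j * d * L₂) * (l * ((a * d - b * c) * (- c)) * M₁ + m * ((a * d - b * c) * a) * M₂)
      ≡ (a * d - b * c) * (a * d - b * c) * (i * l * (L₁ * M₁) + j * m * (L₂ * M₂))
    expand = solve-∀ ℚ-ring

  heat-slash : ∀ R → Heat₂ R → Heat₂ (slash R γ)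
  heat-slash R heatR a₁ a₂ b₁ b₂ n = begin
    ℕ→ℚ n * sumOver A B (K a₁ b₁)
      ≡⟨ sym (sumOver-*ˡ A B (ℕ→ℚ n) (K a₁ b₁)) ⟩
    sumOver A B (λ i j l m → ℕ→ℚ n * K a₁ b₁ i j l m)
      ≡⟨ sumOver-cong A B (λ i j l m _ _ → apply-heat i j l m) ⟩
    sumOver A B (λ i j l m → X i j l m + Y i j l m)
      ≡⟨ sumOver-+ A B X Y ⟩
    sumOver A B X + sumOver A B Y
      ≡⟨ cong₂ _+_ (sym (sumOver-shift₁ A B H₁)) (sym (sumOver-shift₂ A B H₂)) ⟩
    sumOver (suc A) (suc B) X′ + sumOver (suc A) (suc B) Y′
      ≡⟨ sym (sumOver-+ (suc A) (suc B) X′ Y′) ⟩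
    sumOver (suc A) (suc B) (λ i j l m → X′ i j l m + Y′ i j l m)
      ≡⟨ sumOver-cong (suc A) (suc B) (λ i j l m i+j≡ l+m≡ → sym (kernel-heat i j l m i+j≡ l+m≡)) ⟩
    sumOver (suc A) (suc B) (λ i j l m → κ₁ * K (suc a₁) (suc b₁) i j l m + κ₂ * K a₁ b₁ i j l m)
      ≡⟨ sumOver-+ (suc A) (suc B) (λ i j l m → κ₁ * K (suc a₁) (suc b₁) i j l m) (λ i j l m → κ₂ * K a₁ b₁ i j l m) ⟩
    sumOver (suc A) (suc B) (λ i j l m → κ₁ * K (suc a₁) (suc b₁) i j l m)
    + sumOver (suc A) (suc B) (λ i j l m → κ₂ * K a₁ b₁ i j l m)
      ≡⟨ cong₂ _+_ (sumOver-*ˡ (suc A) (suc B) κ₁ (K (suc a₁) (suc b₁))) (sumOver-*ˡ (suc A) (suc B) κ₂ (K a₁ b₁)) ⟩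
    κ₁ * sumOver (suc A) (suc B) (K (suc a₁) (suc b₁)) + κ₂ * sumOver (suc A) (suc B) (K a₁ b₁)
      ≡⟨ cong (λ z → κ₁ * sumOver (suc A) (suc B) (K (suc a₁) (suc b₁)) + κ₂ * z)
           (cong₂ (λ A′ B′ → sumOver A′ B′ (K a₁ b₁)) (sym (ℕP.+-suc a₁ a₂)) (sym (ℕP.+-suc b₁ b₂))) ⟩
    κ₁ * slash R γ (suc a₁) a₂ (suc b₁) b₂ n + κ₂ * slash R γ a₁ (suc a₂) b₁ (suc b₂) n ∎
    where
    open ≡-Reasoning
    A = a₁ ℕ.+ a₂
    B = b₁ ℕ.+ b₂
    κ₁ = ℕ→ℚ (suc a₁) * ℕ→ℚ (suc b₁)
    κ₂ = ℕ→ℚ (suc a₂) * ℕ→ℚ (suc b₂)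
    K : ℕ → ℕ → ℕ → ℕ → ℕ → ℕ → ℚ
    K e f i j l m = R i j l m n * (Lx i j e * My l m f)
    H₁ H₂ : ℕ → ℕ → ℕ → ℕ → ℚ
    H₁ i j l m = R i j l m n * (Lx (i ∸ 1) j a₁ * My (l ∸ 1) m b₁)
    H₂ i j l m = R i j l m n * (Lx i (j ∸ 1) a₁ * My l (m ∸ 1) b₁)
    X Y X′ Y′ : ℕ → ℕ → ℕ → ℕ → ℚ
    X i j l m = ℕ→ℚ (suc i) * ℕ→ℚ (suc l) * H₁ (suc i) j (suc l) m
    Y i j l m = ℕ→ℚ (suc j) * ℕ→ℚ (suc m) * H₂ i (suc j) l (suc m)
    X′ i j l m = ℕ→ℚ i * ℕ→ℚ l * H₁ i j l m
    Y′ i j l m = ℕ→ℚ j * ℕ→ℚ m * H₂ i j l m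
    apply-heat : ∀ i j l m → ℕ→ℚ n * K a₁ b₁ i j l m ≡ X i j l m + Y i j l m
    apply-heat i j l m = trans (sym (ℚP.*-assoc (ℕ→ℚ n) (R i j l m n) ψ))
      (trans (cong (_* ψ) (heatR i j l m n))
             (distrib (ℕ→ℚ (suc i) * ℕ→ℚ (suc l)) (R (suc i) j (suc l) m n) (ℕ→ℚ (suc j) * ℕ→ℚ (suc m)) (R i (suc j) l (suc m) n) ψ))
      where
      ψ = Lx i j a₁ * My l m b₁
      distrib : ∀ p x q y ψ → (p * x + q * y) * ψ ≡ p * (x * ψ) + q * (y * ψ)
      distrib = solve-∀ ℚ-ring
    kernel-heat : ∀ i j l m → i ℕ.+ j ≡ suc A → l ℕ.+ m ≡ suc B →
      κ₁ * K (suc a₁) (suc b₁) i j l m + κ₂ * K a₁ b₁ i j l m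
      ≡ X′ i j l m + Y′ i j l m
    kernel-heat i j l m i+j≡ l+m≡ =
      trans (factor κ₁ κ₂ (R i j l m n) (Lx i j (suc a₁) * My l m (suc b₁)) (Lx i j a₁ * My l m b₁))
      (trans (cong (R i j l m n *_) (linCoeff-heat {i} {j} {l} {m} a₁ a₂ b₁ b₂ i+j≡ l+m≡))
             (sym (factor (ℕ→ℚ i * ℕ→ℚ l) (ℕ→ℚ j * ℕ→ℚ m) (R i j l m n)
                        (Lx (i ∸ 1) j a₁ * My (l ∸ 1) m b₁) (Lx i (j ∸ 1) a₁ * My l (m ∸ 1) b₁))))
      where
      factor : ∀ p q r x y → p * (r * x) + q * (r * y) ≡ r * (p * x + q * y)
      factor = solve-∀ ℚ-ring

heat-B2 : Heat₂ B2
heat-B2 = heat-+₄ _ _ (heat-+₄ _ _ (heat-·₄ (frac 1 3) _ PB-terms) (heat-·₄ (- frac 1 12) _ Rstar-terms))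
                      (heat-·₄ (- frac 1 12) _ Rsh-terms)
  where
  heat-PB : Heat₂ PB
  heat-PB = heat-⊗ B1 B1 heat-B1 heat-B1
  PB-terms : Heat₂ (slash PB 𝟙 +₄ slash PB T⁻¹)
  PB-terms = heat-+₄ _ _ (heat-slash 𝟙 refl _ heat-PB) (heat-slash T⁻¹ refl _ heat-PB)
  Rstar-terms : Heat₂ ((ℕ→ℚ 5 ·₄ slash (Rstar B1) 𝟙) +₄ ((- ℕ→ℚ 3) ·₄ slash (Rstar B1) U) +₄ slash (Rstar B1) (U ⊗ ε))
  Rstar-terms = heat-+₄ _ _ (heat-+₄ _ _ (heat-·₄ (ℕ→ℚ 5) _ (heat-slash 𝟙 refl _ heat-Rstar-B1))
                                         (heat-·₄ (- ℕ→ℚ 3) _ (heat-slash U refl _ heat-Rstar-B1)))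
                            (heat-slash (U ⊗ ε) refl _ heat-Rstar-B1)
    where heat-Rstar-B1 = heat-Rstar B1 heat-B1
  Rsh-terms : Heat₂ ((ℕ→ℚ 5 ·₄ slash (Rsh B1) T⁻¹) +₄ ((- ℕ→ℚ 3) ·₄ slash (Rsh B1) (T⁻¹ ⊗ ε)) +₄ slash (Rsh B1) (T⁻¹ ⊗ U))
  Rsh-terms = heat-+₄ _ _ (heat-+₄ _ _ (heat-·₄ (ℕ→ℚ 5) _ (heat-slash T⁻¹ refl _ heat-Rsh-B1))
                                       (heat-·₄ (- ℕ→ℚ 3) _ (heat-slash (T⁻¹ ⊗ ε) refl _ heat-Rsh-B1)))
                          (heat-slash (T⁻¹ ⊗ U) refl _ heat-Rsh-B1)
    where heat-Rsh-B1 = heat-Rsh B1 heat-B1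

Dq-!·ₚ-heat₁ : ∀ {T} → Heat₁ T → ∀ r s n →
  ℕ→ℚ (suc r) * (ℕ→ℚ (suc s !) * T (suc r) (suc s) n) ≡ Dq (ℕ→ℚ (s !) ·ₚ T r s) n
Dq-!·ₚ-heat₁ {T} heatT r s n = begin
  ℕ→ℚ (suc r) * (ℕ→ℚ (suc s !) * T (suc r) (suc s) n)
    ≡⟨ cong (λ z → ℕ→ℚ (suc r) * (z * T (suc r) (suc s) n)) (ℕ→ℚ-* (suc s) (s !)) ⟩
  ℕ→ℚ (suc r) * (ℕ→ℚ (suc s) * ℕ→ℚ (s !) * T (suc r) (suc s) n)
    ≡⟨ regroup (ℕ→ℚ (suc r)) (ℕ→ℚ (suc s)) (ℕ→ℚ (s !)) (T (suc r) (suc s) n) ⟩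
  ℕ→ℚ (s !) * (ℕ→ℚ (suc r) * ℕ→ℚ (suc s) * T (suc r) (suc s) n)
    ≡⟨ cong (ℕ→ℚ (s !) *_) (sym (heatT r s n)) ⟩
  ℕ→ℚ (s !) * (ℕ→ℚ n * T r s n)
    ≡⟨ commute (ℕ→ℚ (s !)) (ℕ→ℚ n) (T r s n) ⟩
  ℕ→ℚ n * (ℕ→ℚ (s !) * T r s n) ∎
  where
  open ≡-Reasoning
  regroup : ∀ r s f t → r * (s * f * t) ≡ f * (r * s * t)
  regroup = solve-∀ ℚ-ring
  commute : ∀ f n t → f * (n * t) ≡ n * (f * t)
  commute = solve-∀ ℚ-ring

Dq-!·ₚ-heat₂ : ∀ {R} → Heat₂ R → ∀ a₁ a₂ b₁ b₂ n →
  ℕ→ℚ (suc a₁) * (ℕ→ℚ (suc b₁ ! ℕ.* b₂ !) * R (suc a₁) a₂ (suc b₁) b₂ n)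
  + ℕ→ℚ (suc a₂) * (ℕ→ℚ (b₁ ! ℕ.* suc b₂ !) * R a₁ (suc a₂) b₁ (suc b₂) n)
  ≡ Dq (ℕ→ℚ (b₁ ! ℕ.* b₂ !) ·ₚ R a₁ a₂ b₁ b₂) n
Dq-!·ₚ-heat₂ {R} heatR a₁ a₂ b₁ b₂ n = begin
  ℕ→ℚ (suc a₁) * (ℕ→ℚ (suc b₁ ! ℕ.* b₂ !) * R₁) + ℕ→ℚ (suc a₂) * (ℕ→ℚ (b₁ ! ℕ.* suc b₂ !) * R₂)
    ≡⟨ cong₂ (λ x y → ℕ→ℚ (suc a₁) * (x * R₁) + ℕ→ℚ (suc a₂) * (y * R₂))
         (trans (ℕ→ℚ-* (suc b₁ !) (b₂ !)) (cong (_* f₂) (ℕ→ℚ-* (suc b₁) (b₁ !))))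
         (trans (ℕ→ℚ-* (b₁ !) (suc b₂ !)) (cong (f₁ *_) (ℕ→ℚ-* (suc b₂) (b₂ !)))) ⟩
  ℕ→ℚ (suc a₁) * (ℕ→ℚ (suc b₁) * f₁ * f₂ * R₁) + ℕ→ℚ (suc a₂) * (f₁ * (ℕ→ℚ (suc b₂) * f₂) * R₂)
    ≡⟨ regroup (ℕ→ℚ (suc a₁)) (ℕ→ℚ (suc a₂)) (ℕ→ℚ (suc b₁)) (ℕ→ℚ (suc b₂)) f₁ f₂ R₁ R₂ ⟩
  f₁ * f₂ * (ℕ→ℚ (suc a₁) * ℕ→ℚ (suc b₁) * R₁ + ℕ→ℚ (suc a₂) * ℕ→ℚ (suc b₂) * R₂)
    ≡⟨ cong (f₁ * f₂ *_) (sym (heatR a₁ a₂ b₁ b₂ n)) ⟩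
  f₁ * f₂ * (ℕ→ℚ n * R a₁ a₂ b₁ b₂ n)
    ≡⟨ commute (f₁ * f₂) (ℕ→ℚ n) (R a₁ a₂ b₁ b₂ n) ⟩
  ℕ→ℚ n * (f₁ * f₂ * R a₁ a₂ b₁ b₂ n)
    ≡⟨ cong (λ z → ℕ→ℚ n * (z * R a₁ a₂ b₁ b₂ n)) (sym (ℕ→ℚ-* (b₁ !) (b₂ !))) ⟩
  ℕ→ℚ n * (ℕ→ℚ (b₁ ! ℕ.* b₂ !) * R a₁ a₂ b₁ b₂ n) ∎
  where
  open ≡-Reasoning
  f₁ = ℕ→ℚ (b₁ !)
  f₂ = ℕ→ℚ (b₂ !)
  R₁ = R (suc a₁) a₂ (suc b₁) b₂ n
  R₂ = R a₁ (suc a₂) b₁ (suc b₂) n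
  regroup : ∀ α₁ α₂ β₁ β₂ f₁ f₂ x y →
    α₁ * (β₁ * f₁ * f₂ * x) + α₂ * (f₁ * (β₂ * f₂) * y) ≡ f₁ * f₂ * (α₁ * β₁ * x + α₂ * β₂ * y)
  regroup = solve-∀ ℚ-ring
  commute : ∀ f n t → f * (n * t) ≡ n * (f * t)
  commute = solve-∀ ℚ-ring

ρ-∂gen : ∀ {K} g → IsGenOfWeight K g → ∀ n → ρ (∂gen g) n ≡ Dq (ρgen g) n
ρ-∂gen (G₁ zero _)              (() , _)
ρ-∂gen (G₁ (suc k) d)           _ n = trans (ℚP.+-identityʳ _) (Dq-!·ₚ-heat₁ heat-B1 k d n)
ρ-∂gen (G₂ zero _ _ _)          (() , _)
ρ-∂gen (G₂ (suc _) zero _ _)    (_ , () , _)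
ρ-∂gen (G₂ (suc k₁) (suc k₂) d₁ d₂) _ n =
  trans (cong (λ t → ℕ→ℚ (suc k₁) * ρgen (G₂ (suc (suc k₁)) (suc k₂) (suc d₁) d₂) n + t) (ℚP.+-identityʳ _))
        (Dq-!·ₚ-heat₂ heat-B2 k₁ k₂ d₁ d₂ n)

ρ-∂-∷ : ∀ c g x n → ρ (∂ ((c , g) ∷ x)) n ≡ c * ρ (∂gen g) n + ρ (∂ x) n
ρ-∂-∷ c (G₁ k d) x n = distrib₁ c (ℕ→ℚ k) _ (ρ (∂ x) n)
  where
  distrib₁ : ∀ c k r t → c * k * r + t ≡ c * (k * r + 0ℚ) + t
  distrib₁ = solve-∀ ℚ-ring
ρ-∂-∷ c (G₂ k₁ k₂ d₁ d₂) x n = distrib₂ c (ℕ→ℚ k₁) _ (ℕ→ℚ k₂) _ (ρ (∂ x) n)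
  where
  distrib₂ : ∀ c k₁ r₁ k₂ r₂ t → c * k₁ * r₁ + (c * k₂ * r₂ + t) ≡ c * (k₁ * r₁ + (k₂ * r₂ + 0ℚ)) + t
  distrib₂ = solve-∀ ℚ-ring

Dq-ρ-∷ : ∀ c g x n → c * Dq (ρgen g) n + Dq (ρ x) n ≡ Dq (ρ ((c , g) ∷ x)) n
Dq-ρ-∷ c g x n = distrib (ℕ→ℚ n) c (ρgen g n) (ρ x n)
  where
  distrib : ∀ n c r t → c * (n * r) + n * t ≡ n * (c * r + t)
  distrib = solve-∀ ℚ-ring

-- Only the positivity of the entries k, k₁, k₂ of each generator is used, not the common weight.
proposition3p8 : (k : ℕ) → 1 ≤ k → (x : Comb) → All (λ t → IsGenOfWeight k (proj₂ t)) x →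
    (n : ℕ) → ρ (∂ x) n ≡ Dq (ρ x) n
proposition3p8 k 1≤k []              []               n = sym (ℚP.*-zeroʳ (ℕ→ℚ n))
proposition3p8 k 1≤k ((c , g) ∷ x) (g-gen ∷ x-gens) n = begin
  ρ (∂ ((c , g) ∷ x)) n               ≡⟨ ρ-∂-∷ c g x n ⟩
  c * ρ (∂gen g) n + ρ (∂ x) n        ≡⟨ cong₂ (λ u v → c * u + v) (ρ-∂gen g g-gen n) (proposition3p8 k 1≤k x x-gens n) ⟩
  c * Dq (ρgen g) n + Dq (ρ x) n      ≡⟨ Dq-ρ-∷ c g x n ⟩
  Dq (ρ ((c , g) ∷ x)) n              ∎
  where open ≡-Reasoning
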